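{- Homotopy-initial $P$-algebras are unique up to a contractible type of $P$-algebra equivalences: the type $(\Pi C:\mathsf{Alg})(\Pi D:\mathsf{Alg})\big(\mathsf{ishinit}(C)\times\mathsf{ishinit}(D)\to\mathsf{iscontr}(\mathsf{AlgEquiv}(C,D))\big)$ is inhabited.
   Context: Work in the intensional Martin-Löf type theory $\mathcal{H}$ with $\Sigma$-types, $\Pi$-types (with judgemental $\eta$), identity types, a universe $\mathsf{U}$ closed under $\Sigma,\Pi,\mathsf{Id}$, and function extensionality; no UIP. $\mathsf{iscontr}(X):=(\Sigma x:X)(\Pi y:X)\mathsf{Id}(x,y)$. Fix $A:\mathsf{U}$, $B:A\to\mathsf{U}$; $PC:=(\Sigma x:A)(B(x)\to C)$, $Pf(x,u)=(x,f\circ u)$. $\mathsf{Alg}:=(\Sigma C:\mathsf{U})(PC\to C)$; $\mathsf{Alg}(C,D):=(\Sigma f:C\to D)\mathsf{Id}(f\circ\sup_C,\sup_D\circ Pf)$. Composite of $(f,\bar f):C\to D$, $(g,\bar g):D\to E$: $g\circ f$ with path obtained by concatenating $g\circ\bar f$, $\bar g\circ Pf$ and $\sup_E$ whiskered with the canonical path $\mathsf{Id}(Pg\circ Pf,P(g\circ f))$; identity: $1_C$ with the canonical path from $\mathsf{Id}(P(1_C),1_{PC})$. $\mathsf{isalgequiv}(f):=(\Sigma g:\mathsf{Alg}(D,C))\mathsf{Id}(gf,1_C)\times(\Sigma h:\mathsf{Alg}(D,C))\mathsf{Id}(fh,1_D)$; $\mathsf{AlgEquiv}(C,D):=(\Sigma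 f:\mathsf{Alg}(C,D))\mathsf{isalgequiv}(f)$. $\mathsf{ishinit}(C):=(\Pi D:\mathsf{Alg})\mathsf{iscontr}(\mathsf{Alg}(C,D))$. -}

{-# OPTIONS --without-K #-}
module Defs where

open import Level using (Level; 0ℓ; suc; Setω)
open import Function using (_∘_; id)
open import Data.Product using (Σ; _,_; proj₁; proj₂; _×_)
open import Relation.Binary.PropositionalEquality using (_≡_; refl; trans; cong)
open import Axiom.Extensionality.Propositional using (Extensionality)

FunExt : Setω
FunExt = ∀ {a b : Level} → Extensionality a b

iscontr : ∀ {ℓ} → Set ℓ → Set ℓ
iscontr X = Σ X (λ x → ∀ y → x ≡ y)

module _ {A : Set} (B : A → Set) where

  P : Set → Set
  P C = Σ A (λ x → B x → C)

  Pmap : {C D : Set} → (C → D) → P C → P D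
  Pmap f p = proj₁ p , f ∘ proj₂ p

  -- canonical paths (definitional by η for Σ and Π, hence refl)
  Pcomp : {C D E : Set} (f : C → D) (g : D → E) → Pmap g ∘ Pmap f ≡ Pmap (g ∘ f)
  Pcomp f g = refl

  Pid : {C : Set} → Pmap (id {A = C}) ≡ id
  Pid = refl

  Alg : Set₁
  Alg = Σ Set (λ C → P C → C)

  AlgHom : Alg → Alg → Set
  AlgHom (C , supC) (D , supD) = Σ (C → D) (λ f → f ∘ supC ≡ supD ∘ Pmap f)

  _∘A_ : {C D E : Alg} → AlgHom D E → AlgHom C D → AlgHom C E
  _∘A_ {C , supC} {D , supD} {E , supE} (g , ḡ) (f , f̄) =
    g ∘ f ,
    trans (cong (g ∘_) f̄)
      (trans (cong (_∘ Pmap f) ḡ)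
             (cong (supE ∘_) (Pcomp f g)))

  idA : (C : Alg) → AlgHom C C
  idA (C , supC) = id , cong (supC ∘_) (Pid {C})

  isalgequiv : {C D : Alg} → AlgHom C D → Set
  isalgequiv {C} {D} f =
    Σ (AlgHom D C) (λ g → _∘A_ {C} {D} {C} g f ≡ idA C)
    × Σ (AlgHom D C) (λ h → _∘A_ {D} {C} {D} f h ≡ idA D)

  AlgEquiv : Alg → Alg → Set
  AlgEquiv C D = Σ (AlgHom C D) (λ f → isalgequiv {C} {D} f)

  ishinit : Alg → Set₁
  ishinit C = (D : Alg) → iscontr (AlgHom C D)

{-# OPTIONS --without-K #-}
-- Homotopy-initiality makes every hom type between C and D, in either
-- direction and including the endomorphism types, contractible; hence so are
-- the path types between homomorphisms. AlgEquiv C D is an iterated Σ over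
-- these types, and contractible types are closed under Σ.
module Submission where

open import Defs
open import Data.Product using (Σ; _×_; _,_; proj₁; proj₂)
open import Relation.Binary.PropositionalEquality using (_≡_; refl; trans; sym; cong)
open import Relation.Binary.PropositionalEquality.Properties using (trans-symˡ)

iscontr-≡ : ∀ {ℓ} {X : Set ℓ} → iscontr X → (x y : X) → iscontr (x ≡ y)
iscontr-≡ {X = X} (c , contract) x y = path x y , path-unique
  where
  path : (x y : X) → x ≡ y
  path x y = trans (sym (contract x)) (contract y)

  path-unique : ∀ {x y} (p : x ≡ y) → path x y ≡ p
  path-unique {x} refl = trans-symˡ (contract x)

iscontr-Σ : ∀ {a b} {X : Set a} {Y : X → Set b} →
            iscontr X → (∀ x → iscontr (Y x)) → iscontr (Σ X Y)
iscontr-Σ {Y = Y} (c , contract) contrY = (c , proj₁ (contrY c)) , λ (x , y) → over (contract x) y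
  where
  over : ∀ {x} (p : c ≡ x) (y : Y x) → (c , proj₁ (contrY c)) ≡ (x , y)
  over refl y = cong (c ,_) (proj₂ (contrY c) y)

iscontr-× : ∀ {a b} {X : Set a} {Y : Set b} → iscontr X → iscontr Y → iscontr (X × Y)
iscontr-× contrX contrY = iscontr-Σ contrX (λ _ → contrY)

module _ {A : Set} (B : A → Set) {C D : Alg B} where

  iscontr-isalgequiv : iscontr (AlgHom B D C) → iscontr (AlgHom B C C) → iscontr (AlgHom B D D) →
                       (f : AlgHom B C D) → iscontr (isalgequiv B {C} {D} f)
  iscontr-isalgequiv contrDC contrCC contrDD f =
    iscontr-× (iscontr-Σ contrDC (λ g → iscontr-≡ contrCC _ _))
              (iscontr-Σ contrDC (λ h → iscontr-≡ contrDD _ _))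

proposition5p2 : FunExt → (A : Set) (B : A → Set) → (C D : Alg B)
    → ishinit B C × ishinit B D → iscontr (AlgEquiv B C D)
proposition5p2 _ A B C D (initC , initD) =
  iscontr-Σ (initC D) (iscontr-isalgequiv B (initD C) (initC C) (initD D))
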